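{- There is no strictly Deza graph with parameters $(n,k,k-1,k-2)$.
   Context: All graphs are finite, undirected, without loops or multiple edges. A nonempty $k$-regular graph $\Gamma$ on $n$ vertices is a Deza graph with parameters $(n,k,b,a)$, $b\ge a$, if every pair of distinct vertices has either exactly $b$ or exactly $a$ common neighbours. A strictly Deza graph is a Deza graph of diameter $2$ that is not strongly regular. -}

module Defs where

open import Data.Nat using (ℕ; zero; suc; _+_; _>_; _≥_)
open import Data.Fin using (Fin; zero; suc)
open import Data.Bool using (Bool; true; false; T; _∧_)
open import Data.Product using (Σ; _×_; ∃; ∃-syntax)
open import Data.Sum using (_⊎_)
open import Relation.Nullary using (¬_)
open import Relation.Binary.PropositionalEquality using (_≡_)

count : ∀ {n} → (Fin n → Bool) → ℕ
count {zero}  p = 0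
count {suc n} p = (if p zero then 1 else 0) + count (λ i → p (suc i))
  where open import Data.Bool using (if_then_else_)

record Graph (n : ℕ) : Set where
  field
    adj     : Fin n → Fin n → Bool
    sym     : ∀ u v → adj u v ≡ adj v u
    irrefl  : ∀ v → adj v v ≡ false

open Graph public

Adjacent : ∀ {n} → Graph n → Fin n → Fin n → Set
Adjacent G u v = T (adj G u v)

degree : ∀ {n} → Graph n → Fin n → ℕ
degree G v = count (adj G v)

common : ∀ {n} → Graph n → Fin n → Fin n → ℕ
common G u v = count (λ w → adj G u w ∧ adj G v w)

IsRegular : ∀ {n} → Graph n → ℕ → Set
IsRegular G k = ∀ v → degree G v ≡ k

IsDeza : ∀ {n} → Graph n → ℕ → ℕ → ℕ → Set
IsDeza {n} G k b a =
  n ≥ 1 × b ≥ a × IsRegular G k ×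
  (∀ u v → ¬ u ≡ v → common G u v ≡ b ⊎ common G u v ≡ a)

IsStronglyRegular : ∀ {n} → Graph n → Set
IsStronglyRegular G =
  ∃[ k ] ∃[ λ' ] ∃[ μ ]
    (IsRegular G k ×
     (∀ u v → Adjacent G u v → common G u v ≡ λ') ×
     (∀ u v → ¬ u ≡ v → ¬ Adjacent G u v → common G u v ≡ μ))

HasDiameter2 : ∀ {n} → Graph n → Set
HasDiameter2 G =
  (∀ u v → ¬ u ≡ v → Adjacent G u v ⊎ common G u v > 0) ×
  (∃[ u ] ∃[ v ] (¬ u ≡ v × ¬ Adjacent G u v))

-- Write k = a + 2, b = a + 1, and let β(u) count the vertices w with c(u,w) ≥ b
-- (u itself included, as c(u,u) = k).  Counting walks of length two from u gives
-- k² = Σ_w c(u,w) ≥ n·a + β(u) + 1, and a pair of distinct non-adjacent vertices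
-- gives n ≥ 2k + 2 − b = a + 5; together β(u) ≤ 3.
-- If n = a + 5 (by the same count) or a = 0 (by diameter 2), every non-adjacent
-- pair has b common neighbours, so N(u) and the b-partners of u cover all vertices;
-- an adjacent pair with b common neighbours would make them overlap and give
-- n < β(u) + k ≤ a + 5, so the graph is strongly regular with λ = a, μ = b.
-- Otherwise a ≥ 1 and n ≥ a + 6, the walk count gives β(u) ≤ 1, no pair has
-- b common neighbours and the graph is strongly regular with λ = μ = a.
module Submission where

open import Defs
open import Data.Nat using (ℕ; _+_)
open import Data.Product using (_×_)
open import Relation.Nullary using (¬_)
open import Relation.Binary.PropositionalEquality using (_≡_)

open import Data.Bool using (Bool; true; false; T; not; _∧_; _∨_; if_then_else_)
open import Data.Bool.Properties using (∧-idem; T-∧; T-∨)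
open import Data.Fin using (Fin; zero; suc)
open import Data.Fin.Properties using () renaming (_≟_ to _≟ᶠ_)
open import Data.Nat using (suc; _*_; _∸_; _≤_; _<_; _≤ᵇ_; z≤n; s≤s; _≤?_)
open import Data.Nat.Properties
open import Algebra.Properties.CommutativeSemigroup +-commutativeSemigroup using (interchange)
open import Algebra.Properties.Semiring.Sum +-*-semiring
  using (sum-syntax; sum-cong-≗; ∑-comm; ∑-distrib-+; *-distribʳ-sum)
open import Data.Nat.Tactic.RingSolver using (solve-∀)
open import Data.Product using (_,_)
open import Data.Empty using (⊥-elim)
open import Data.Sum using (_⊎_; inj₁; inj₂; [_,_])
open import Function using (_∘_; id; Equivalence)
open import Relation.Nullary using (yes; no; contradiction)
open import Relation.Nullary.Decidable using (T?)
open import Relation.Binary.PropositionalEquality as ≡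
  using (_≢_; refl; trans; cong; cong₂; subst; subst₂; module ≡-Reasoning)

open Equivalence using (to; from)

indicator : Bool → ℕ
indicator b = if b then 1 else 0

indicator≤1 : ∀ b → indicator b ≤ 1
indicator≤1 true  = ≤-refl
indicator≤1 false = z≤n

indicator-∧+indicator-∨ : ∀ x y → indicator (x ∧ y) + indicator (x ∨ y) ≡ indicator x + indicator y
indicator-∧+indicator-∨ true  true  = refl
indicator-∧+indicator-∨ true  false = refl
indicator-∧+indicator-∨ false true  = refl
indicator-∧+indicator-∨ false false = refl

m+[1+m≤ᵇn]≤n : ∀ {m n} → m ≤ n → m + indicator (suc m ≤ᵇ n) ≤ n
m+[1+m≤ᵇn]≤n {m} {n} m≤n with suc m ≤ᵇ n in eq
... | true  = subst (_≤ n) (+-comm 1 m) (≤ᵇ⇒≤ (suc m) n (subst T (≡.sym eq) _))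
... | false = subst (_≤ n) (≡.sym (+-identityʳ m)) m≤n

∑-const : ∀ n c → ∑[ i < n ] c ≡ n * c
∑-const 0       c = refl
∑-const (suc n) c = cong (c +_) (∑-const n c)

∑-mono-≤ : ∀ {n} {f g : Fin n → ℕ} → (∀ i → f i ≤ g i) → ∑[ i < n ] f i ≤ ∑[ i < n ] g i
∑-mono-≤ {0}     f≤g = z≤n
∑-mono-≤ {suc n} f≤g = +-mono-≤ (f≤g zero) (∑-mono-≤ (f≤g ∘ suc))

∑-mono-< : ∀ {n} {f g : Fin n → ℕ} → (∀ i → f i ≤ g i) → ∀ j → f j < g j →
           ∑[ i < n ] f i < ∑[ i < n ] g i
∑-mono-< f≤g zero    fj<gj = +-mono-<-≤ fj<gj (∑-mono-≤ (f≤g ∘ suc))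
∑-mono-< f≤g (suc j) fj<gj = +-mono-≤-< (f≤g zero) (∑-mono-< (f≤g ∘ suc) j fj<gj)

count≡∑ : ∀ {n} (p : Fin n → Bool) → count p ≡ ∑[ i < n ] indicator (p i)
count≡∑ {0}     p = refl
count≡∑ {suc n} p = cong (indicator (p zero) +_) (count≡∑ (p ∘ suc))

count-cong : ∀ {n} {p q : Fin n → Bool} → (∀ i → p i ≡ q i) → count p ≡ count q
count-cong {0}     p≗q = refl
count-cong {suc n} p≗q = cong₂ _+_ (cong indicator (p≗q zero)) (count-cong (p≗q ∘ suc))

count-all : ∀ {n} (p : Fin n → Bool) → (∀ i → T (p i)) → count p ≡ n
count-all {0}     p all = refl
count-all {suc n} p all with p zero | all zero
... | true | _ = cong suc (count-all (p ∘ suc) (all ∘ suc))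

count-complement : ∀ {n} (p : Fin n → Bool) → count p + count (not ∘ p) ≡ n
count-complement {0}     p = refl
count-complement {suc n} p with p zero
... | true  = cong suc (count-complement (p ∘ suc))
... | false = trans (+-suc _ _) (cong suc (count-complement (p ∘ suc)))

count-∧+count-∨ : ∀ {n} (p q : Fin n → Bool) →
                  count (λ i → p i ∧ q i) + count (λ i → p i ∨ q i) ≡ count p + count q
count-∧+count-∨ {0}     p q = refl
count-∧+count-∨ {suc n} p q = begin
  (indicator (p₀ ∧ q₀) + count (λ i → p′ i ∧ q′ i)) + (indicator (p₀ ∨ q₀) + count (λ i → p′ i ∨ q′ i))
    ≡⟨ interchange (indicator (p₀ ∧ q₀)) _ (indicator (p₀ ∨ q₀)) _ ⟩
  (indicator (p₀ ∧ q₀) + indicator (p₀ ∨ q₀)) + (count (λ i → p′ i ∧ q′ i) + count (λ i → p′ i ∨ q′ i))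
    ≡⟨ cong₂ _+_ (indicator-∧+indicator-∨ p₀ q₀) (count-∧+count-∨ p′ q′) ⟩
  (indicator p₀ + indicator q₀) + (count p′ + count q′)
    ≡⟨ interchange (indicator p₀) _ (count p′) _ ⟩
  (indicator p₀ + count p′) + (indicator q₀ + count q′)
    ∎
  where
  open ≡-Reasoning
  p₀ = p zero
  q₀ = q zero
  p′ = p ∘ suc
  q′ = q ∘ suc

count-pos : ∀ {n} (p : Fin n → Bool) {i} → T (p i) → 1 ≤ count p
count-pos p {zero} pᵢ with p zero
count-pos p {zero} _  | true = s≤s z≤n
count-pos p {suc i} pᵢ = ≤-trans (count-pos (p ∘ suc) pᵢ) (m≤n+m _ _)

count≥2 : ∀ {n} (p : Fin n → Bool) {i j} → T (p i) → T (p j) → i ≢ j → 2 ≤ count p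
count≥2 p {zero}  {zero}  _  _  i≢j = contradiction refl i≢j
count≥2 p {zero}  {suc j} pᵢ pⱼ _   with p zero
count≥2 p {zero}  {suc j} _  pⱼ _   | true = s≤s (count-pos (p ∘ suc) pⱼ)
count≥2 p {suc i} {zero}  pᵢ pⱼ _   with p zero
count≥2 p {suc i} {zero}  pᵢ _  _   | true = s≤s (count-pos (p ∘ suc) pᵢ)
count≥2 p {suc i} {suc j} pᵢ pⱼ i≢j =
  ≤-trans (count≥2 (p ∘ suc) pᵢ pⱼ (i≢j ∘ cong suc)) (m≤n+m _ _)

count+2≤n : ∀ {n} (p : Fin n → Bool) {i j} → ¬ T (p i) → ¬ T (p j) → i ≢ j → count p + 2 ≤ n
count+2≤n {n} p ¬pᵢ ¬pⱼ i≢j = begin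
  count p + 2               ≤⟨ +-monoʳ-≤ (count p) (count≥2 (not ∘ p) (T-not ¬pᵢ) (T-not ¬pⱼ) i≢j) ⟩
  count p + count (not ∘ p) ≡⟨ count-complement p ⟩
  n                         ∎
  where
  open ≤-Reasoning
  T-not : ∀ {x} → ¬ T x → T (not x)
  T-not {true}  ¬x = ¬x _
  T-not {false} _  = _

n<count+count : ∀ {n} (p q : Fin n → Bool) {j} →
                (∀ i → T (p i ∨ q i)) → T (p j ∧ q j) → n < count p + count q
n<count+count {n} p q cover both = begin-strict
  n                                                   ≡⟨ count-all _ cover ⟨
  count (λ i → p i ∨ q i)                             <⟨ +-monoˡ-≤ _ (count-pos (λ i → p i ∧ q i) both) ⟩
  count (λ i → p i ∧ q i) + count (λ i → p i ∨ q i)   ≡⟨ count-∧+count-∨ p q ⟩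
  count p + count q                                   ∎
  where open ≤-Reasoning

[5+a+m]*a+β<[2+a]²⇒a+m*a+β≤3 : ∀ a m β → (5 + a + m) * a + β < (2 + a) * (2 + a) → a + m * a + β ≤ 3
[5+a+m]*a+β<[2+a]²⇒a+m*a+β≤3 a m β lt =
  +-cancelʳ-≤ (1 + 4 * a + a * a) (a + m * a + β) 3 (subst₂ _≤_ (lhs a m β) (rhs a) lt)
  where
  lhs : ∀ a m β → suc ((5 + a + m) * a + β) ≡ a + m * a + β + (1 + 4 * a + a * a)
  lhs = solve-∀
  rhs : ∀ a → (2 + a) * (2 + a) ≡ 3 + (1 + 4 * a + a * a)
  rhs = solve-∀

n*a+β<[2+a]²⇒β≤3 : ∀ {a n β} → 5 + a ≤ n → n * a + β < (2 + a) * (2 + a) → β ≤ 3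
n*a+β<[2+a]²⇒β≤3 {a} {n} {β} 5+a≤n lt =
  ≤-trans (m≤n+m β (a + m * a))
          ([5+a+m]*a+β<[2+a]²⇒a+m*a+β≤3 a m β
             (subst (λ n → n * a + β < (2 + a) * (2 + a)) (≡.sym (m+[n∸m]≡n 5+a≤n)) lt))
  where m = n ∸ (5 + a)

n*a+β<[2+a]²⇒β≤1 : ∀ {a n β} → 1 ≤ a → 6 + a ≤ n → n * a + β < (2 + a) * (2 + a) → β ≤ 1
n*a+β<[2+a]²⇒β≤1 {suc a} {n} {β} _ 6+a≤n lt =
  ≤-pred (≤-pred (≤-trans (m≤n+m (2 + β) _) (subst (_≤ 3) (regroup a m β) bound)))
  where
  m = n ∸ (6 + suc a)
  n≡5+a+[1+m] : n ≡ 5 + suc a + suc m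
  n≡5+a+[1+m] = ≡.sym (trans (+-suc (5 + suc a) m) (m+[n∸m]≡n 6+a≤n))
  bound : suc a + suc m * suc a + β ≤ 3
  bound = [5+a+m]*a+β<[2+a]²⇒a+m*a+β≤3 (suc a) (suc m) β
            (subst (λ n → n * suc a + β < (3 + a) * (3 + a)) n≡5+a+[1+m] lt)
  regroup : ∀ a m β → suc a + suc m * suc a + β ≡ (a + a + m * suc a) + (2 + β)
  regroup = solve-∀

adjacent⇒≢ : ∀ {n} (G : Graph n) {u v} → Adjacent G u v → u ≢ v
adjacent⇒≢ G {u} u~v refl = subst T (irrefl G u) u~v

module Regular {n k} {G : Graph n} (regular : IsRegular G k) where

  common-self : ∀ u → common G u u ≡ k
  common-self u = trans (count-cong (λ w → ∧-idem (adj G u w))) (regular u)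

  ∑-common : ∀ u → ∑[ v < n ] common G u v ≡ k * k
  ∑-common u = begin
    ∑[ v < n ] common G u v                                ≡⟨ sum-cong-≗ (λ v → count≡∑ (λ w → adj G u w ∧ adj G v w)) ⟩
    ∑[ v < n ] ∑[ w < n ] indicator (adj G u w ∧ adj G v w) ≡⟨ ∑-comm (λ v w → indicator (adj G u w ∧ adj G v w)) ⟩
    ∑[ w < n ] ∑[ v < n ] indicator (adj G u w ∧ adj G v w) ≡⟨ sum-cong-≗ column ⟩
    ∑[ w < n ] (indicator (adj G u w) * k)                 ≡⟨ *-distribʳ-sum k (indicator ∘ adj G u) ⟨
    (∑[ w < n ] indicator (adj G u w)) * k                 ≡⟨ cong (_* k) (trans (≡.sym (count≡∑ (adj G u))) (regular u)) ⟩
    k * k                                                  ∎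
    where
    open ≡-Reasoning
    column : ∀ w → ∑[ v < n ] indicator (adj G u w ∧ adj G v w) ≡ indicator (adj G u w) * k
    column w with adj G u w
    ... | true  = begin
      ∑[ v < n ] indicator (adj G v w) ≡⟨ sum-cong-≗ (λ v → cong indicator (Graph.sym G v w)) ⟩
      ∑[ v < n ] indicator (adj G w v) ≡⟨ count≡∑ (adj G w) ⟨
      count (adj G w)                  ≡⟨ regular w ⟩
      k                                ≡⟨ *-identityˡ k ⟨
      1 * k                            ∎
    ... | false = trans (∑-const n 0) (*-zeroʳ n)

  k+k+2≤common+n : ∀ {u v} → u ≢ v → ¬ Adjacent G u v → k + k + 2 ≤ common G u v + n
  k+k+2≤common+n {u} {v} u≢v u≁v = begin
    k + k + 2                                   ≡⟨ cong (_+ 2) (cong₂ _+_ (regular u) (regular v)) ⟨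
    count (adj G u) + count (adj G v) + 2       ≡⟨ cong (_+ 2) (count-∧+count-∨ (adj G u) (adj G v)) ⟨
    common G u v + count N[u]∪N[v] + 2          ≡⟨ +-assoc (common G u v) _ 2 ⟩
    common G u v + (count N[u]∪N[v] + 2)        ≤⟨ +-monoʳ-≤ (common G u v) (count+2≤n N[u]∪N[v] {u} {v} u∉ v∉ u≢v) ⟩
    common G u v + n                            ∎
    where
    open ≤-Reasoning
    N[u]∪N[v] : Fin n → Bool
    N[u]∪N[v] w = adj G u w ∨ adj G v w
    ¬self-loop : ∀ w → ¬ Adjacent G w w
    ¬self-loop w w~w = adjacent⇒≢ G w~w refl
    u∉ : ¬ T (N[u]∪N[v] u)
    u∉ = [ ¬self-loop u , u≁v ∘ subst T (Graph.sym G v u) ] ∘ to T-∨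
    v∉ : ¬ T (N[u]∪N[v] v)
    v∉ = [ u≁v , ¬self-loop v ] ∘ to T-∨

module Deza[k,k-1,k-2] {n} (G : Graph n) (a : ℕ) (regular : IsRegular G (2 + a))
  (deza : ∀ u v → u ≢ v → common G u v ≡ suc a ⊎ common G u v ≡ a) where

  open Regular {G = G} regular

  b-partner : Fin n → Fin n → Bool
  b-partner u w = suc a ≤ᵇ common G u w

  b-degree : Fin n → ℕ
  b-degree u = count (b-partner u)

  b-partner-self : ∀ u → T (b-partner u u)
  b-partner-self u = ≤⇒≤ᵇ (subst (suc a ≤_) (≡.sym (common-self u)) (n≤1+n (suc a)))

  a≤common : ∀ u w → a ≤ common G u w
  a≤common u w with u ≟ᶠ w
  ... | yes refl = subst (a ≤_) (≡.sym (common-self u)) (m≤n+m a 2)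
  ... | no u≢w with deza u w u≢w
  ...   | inj₁ c≡b = subst (a ≤_) (≡.sym c≡b) (n≤1+n a)
  ...   | inj₂ c≡a = ≤-reflexive (≡.sym c≡a)

  common≤b : ∀ {u v} → u ≢ v → common G u v ≤ suc a
  common≤b {u} {v} u≢v with deza u v u≢v
  ... | inj₁ c≡b = ≤-reflexive c≡b
  ... | inj₂ c≡a = ≤-trans (≤-reflexive c≡a) (n≤1+n a)

  walk-bound : ∀ u → n * a + b-degree u < (2 + a) * (2 + a)
  walk-bound u = begin-strict
    n * a + b-degree u                                      ≡⟨ cong₂ _+_ (≡.sym (∑-const n a)) (count≡∑ (b-partner u)) ⟩
    ∑[ w < n ] a + ∑[ w < n ] indicator (b-partner u w)     ≡⟨ ∑-distrib-+ (λ _ → a) (indicator ∘ b-partner u) ⟨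
    ∑[ w < n ] (a + indicator (b-partner u w))              <⟨ ∑-mono-< (λ w → m+[1+m≤ᵇn]≤n (a≤common u w)) u self ⟩
    ∑[ w < n ] common G u w                                 ≡⟨ ∑-common u ⟩
    (2 + a) * (2 + a)                                       ∎
    where
    open ≤-Reasoning
    self : a + indicator (b-partner u u) < common G u u
    self = begin-strict
      a + indicator (b-partner u u) ≤⟨ +-monoʳ-≤ a (indicator≤1 _) ⟩
      a + 1                         ≡⟨ +-comm a 1 ⟩
      suc a                         <⟨ n<1+n (suc a) ⟩
      2 + a                         ≡⟨ common-self u ⟨
      common G u u                  ∎

  b-degree≤3 : 5 + a ≤ n → ∀ u → b-degree u ≤ 3
  b-degree≤3 5+a≤n u = n*a+β<[2+a]²⇒β≤3 5+a≤n (walk-bound u)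

  b-degree≤1 : 1 ≤ a → 6 + a ≤ n → ∀ u → b-degree u ≤ 1
  b-degree≤1 1≤a 6+a≤n u = n*a+β<[2+a]²⇒β≤1 1≤a 6+a≤n (walk-bound u)

  b+[5+a]≤common+n : ∀ {u v} → u ≢ v → ¬ Adjacent G u v → suc a + (5 + a) ≤ common G u v + n
  b+[5+a]≤common+n {u} {v} u≢v u≁v = subst (_≤ common G u v + n) (regroup a) (k+k+2≤common+n u≢v u≁v)
    where
    regroup : ∀ a → 2 + a + (2 + a) + 2 ≡ suc a + (5 + a)
    regroup = solve-∀

  nonadjacent⇒5+a≤n : ∀ {u v} → u ≢ v → ¬ Adjacent G u v → 5 + a ≤ n
  nonadjacent⇒5+a≤n u≢v u≁v = +-cancelˡ-≤ (suc a) (5 + a) n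
    (≤-trans (b+[5+a]≤common+n u≢v u≁v) (+-monoˡ-≤ n (common≤b u≢v)))

  n≤5+a⇒nonadjacent-b : n ≤ 5 + a → ∀ {u v} → u ≢ v → ¬ Adjacent G u v → suc a ≤ common G u v
  n≤5+a⇒nonadjacent-b n≤5+a {u} {v} u≢v u≁v = +-cancelʳ-≤ (5 + a) (suc a) (common G u v)
    (≤-trans (b+[5+a]≤common+n u≢v u≁v) (+-monoʳ-≤ (common G u v) n≤5+a))

  nonadjacent-b⇒strongly-regular : 5 + a ≤ n →
    (∀ {u v} → u ≢ v → ¬ Adjacent G u v → suc a ≤ common G u v) → IsStronglyRegular G
  nonadjacent-b⇒strongly-regular 5+a≤n nonadjacent-b =
    2 + a , a , suc a , regular , adjacent-a , nonadjacent-b′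
    where
    covered : ∀ u w → T (b-partner u w ∨ adj G u w)
    covered u w with u ≟ᶠ w | T? (adj G u w)
    ... | yes refl | _         = from T-∨ (inj₁ (b-partner-self u))
    ... | no _     | yes u~w   = from T-∨ (inj₂ u~w)
    ... | no u≢w   | no u≁w    = from T-∨ (inj₁ (≤⇒≤ᵇ (nonadjacent-b u≢w u≁w)))
    adjacent-a : ∀ u v → Adjacent G u v → common G u v ≡ a
    adjacent-a u v u~v with deza u v (adjacent⇒≢ G u~v)
    ... | inj₂ c≡a = c≡a
    ... | inj₁ c≡b = contradiction 5+a≤n (<⇒≱ (begin-strict
      n                             <⟨ n<count+count (b-partner u) (adj G u) (covered u) v∈both ⟩
      b-degree u + count (adj G u)  ≤⟨ +-mono-≤ (b-degree≤3 5+a≤n u) (≤-reflexive (regular u)) ⟩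
      5 + a                         ∎))
      where
      open ≤-Reasoning
      v∈both : T (b-partner u v ∧ adj G u v)
      v∈both = from T-∧ (≤⇒≤ᵇ (≤-reflexive (≡.sym c≡b)) , u~v)
    nonadjacent-b′ : ∀ u v → u ≢ v → ¬ Adjacent G u v → common G u v ≡ suc a
    nonadjacent-b′ u v u≢v u≁v with deza u v u≢v
    ... | inj₁ c≡b = c≡b
    ... | inj₂ c≡a = contradiction (nonadjacent-b u≢v u≁v) (<-irrefl (≡.sym c≡a))

  sparse⇒strongly-regular : 1 ≤ a → 6 + a ≤ n → IsStronglyRegular G
  sparse⇒strongly-regular 1≤a 6+a≤n =
    2 + a , a , a , regular , (λ u v u~v → common≡a (adjacent⇒≢ G u~v)) , (λ u v u≢v _ → common≡a u≢v)
    where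
    common≡a : ∀ {u v} → u ≢ v → common G u v ≡ a
    common≡a {u} {v} u≢v with deza u v u≢v
    ... | inj₂ c≡a = c≡a
    ... | inj₁ c≡b = contradiction
      (count≥2 (b-partner u) {u} {v} (b-partner-self u) (≤⇒≤ᵇ (≤-reflexive (≡.sym c≡b))) u≢v)
      (≤⇒≯ (b-degree≤1 1≤a 6+a≤n u))

no-strictly-Deza[k,k-1,k-2] : ∀ {n} (G : Graph n) a →
  ¬ (IsDeza G (2 + a) (suc a) a × HasDiameter2 G × ¬ IsStronglyRegular G)
no-strictly-Deza[k,k-1,k-2] {n} G a ((_ , _ , regular , deza) , (distance≤2 , u , v , u≢v , u≁v) , ¬srg) =
  ¬srg strongly-regular
  where
  open Deza[k,k-1,k-2] G a regular deza
  5+a≤n : 5 + a ≤ n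
  5+a≤n = nonadjacent⇒5+a≤n u≢v u≁v
  a≡0⇒nonadjacent-b : a ≡ 0 → ∀ {u v} → u ≢ v → ¬ Adjacent G u v → suc a ≤ common G u v
  a≡0⇒nonadjacent-b a≡0 {u} {v} u≢v u≁v =
    subst (λ x → suc x ≤ common G u v) (≡.sym a≡0) ([ ⊥-elim ∘ u≁v , id ] (distance≤2 u v u≢v))
  strongly-regular : IsStronglyRegular G
  strongly-regular with n ≤? 5 + a | 1 ≤? a
  ... | yes n≤5+a | _       = nonadjacent-b⇒strongly-regular 5+a≤n (n≤5+a⇒nonadjacent-b n≤5+a)
  ... | no n≰5+a  | yes 1≤a = sparse⇒strongly-regular 1≤a (≰⇒> n≰5+a)
  ... | no _      | no 1≰a  = nonadjacent-b⇒strongly-regular 5+a≤n (a≡0⇒nonadjacent-b (n<1⇒n≡0 (≰⇒> 1≰a)))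

lemma2 : (n k b a : ℕ) → (G : Graph n) → b + 1 ≡ k → a + 2 ≡ k →
    ¬ (IsDeza G k b a × HasDiameter2 G × ¬ IsStronglyRegular G)
lemma2 n k b a G b+1≡k a+2≡k =
  subst₂ (λ k b → ¬ (IsDeza G k b a × HasDiameter2 G × ¬ IsStronglyRegular G)) 2+a≡k 1+a≡b
    (no-strictly-Deza[k,k-1,k-2] G a)
  where
  2+a≡k : 2 + a ≡ k
  2+a≡k = trans (+-comm 2 a) a+2≡k
  1+a≡b : suc a ≡ b
  1+a≡b = +-cancelʳ-≡ 1 (suc a) b (trans (≡.sym (+-suc a 1)) (trans a+2≡k (≡.sym b+1≡k)))
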